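{- Let $E$ be a nondeterministic expression and $X$ a variable with $E\rhd\{X\}$ (i.e. $X$ is probabilistically unguarded in $E$). Then $E=E+X$ is provable.
   Context: Fix a set $\mathit{Act}$ of actions containing $\tau$ and a set $\mathit{Var}$ of variables. Nondeterministic expressions: $E ::= \mathbf 0 \mid X \mid \alpha.P \mid \mathrm{rec}\,X.E \mid E+E$; probabilistic expressions: $P ::= \partial(E)\mid P\oplus_p P$ ($0<p<1$); $\alpha.E$ abbreviates $\alpha.\partial(E)$; $\bigoplus_{i\in I}p_iP_i$ (finite $I$, $p_i>0$, $\sum p_i=1$) is an iterated probabilistic choice selecting $P_i$ with probability $p_i$; $\bigoplus_ip_iE_i$ means $\bigoplus_ip_i\partial(E_i)$; substitution is capture-avoiding. $E\rhd V$ ($V\subseteq\mathit{Var}$, also for probabilistic expressions) is the least relation with $X\rhd\{X\}$; $\tau.P\rhd V$ if $P\rhd V$; $\mathrm{rec}\,X.E\rhd V\setminus\{X\}$ if $E\rhd V$ and $V\neq\{X\}$; $E+F\rhd V$ if $E\rhd V$ or $F\rhd V$; $\partial(E)\rhd V$ if $E\rhd V$; $P\oplus_pQ\rhd V\cup W$ if $P\rhd V$, $Q\rhd W$. $X$ is guarded in $E$ unless $E\rhd\{X\}$. Provable equality $=$ is the least relation (on both sorts) that is an equivalence, a congruence for all operators (including under $\mathrm{rec}$), allows renaming of bound variables, contains all instances of the axioms below and is closed under rule R2: N1 $E+F=F+E$; N2 $E+(F+G)=(E+F)+G$; N3 $E+E=E$; N4 $E+\mathbf 0=E$; P1 $P\oplus_pQ=Q\oplus_{1-p}P$;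 P2 $P\oplus_p(Q\oplus_{q/(1-p)}R)=(P\oplus_{p/(p+q)}Q)\oplus_{p+q}R$; P3 $P\oplus_pP=P$; T1 $\alpha.(\partial(\tau.\partial(E))\oplus_pP)=\alpha.(\partial(E)\oplus_pP)$; T2 $\tau.\bigoplus_ip_i(E_i+F)+F=\tau.\bigoplus_ip_i(E_i+F)$; T3 $\tau.\bigoplus_ip_i(E_i+\alpha.P_i)+\alpha.\bigoplus_ip_iP_i=\tau.\bigoplus_ip_i(E_i+\alpha.P_i)$; T4 $\alpha.\bigoplus_ip_i(E_i+\tau.P_i)+\alpha.\bigoplus_ip_iP_i=\alpha.\bigoplus_ip_i(E_i+\tau.P_i)$; C $\alpha.P+\alpha.Q=\alpha.P+\alpha.(P\oplus_pQ)+\alpha.Q$; R1 $\mathrm{rec}\,X.E=E[\mathrm{rec}\,X.E/X]$; R2 if $F=E[F/X]$ and $X$ is guarded in $E$, then $F=\mathrm{rec}\,X.E$; R3 $\mathrm{rec}\,X.(\tau.(\partial(X+E)\oplus_pP)+F)=\mathrm{rec}\,X.(\tau.(\partial(X+E)\oplus_pP)+\tau.P+F)$; R4 $\mathrm{rec}\,X.(X+E)=\mathrm{rec}\,X.E$; R5 $\mathrm{rec}\,X.(\tau.\partial(X)+E)=\mathrm{rec}\,X.\tau.\partial(E)$; R6 $\mathrm{rec}\,X.(\tau.\bigoplus_ip_i(X+E_i)+F)=\mathrm{rec}\,X.(\tau.\partial(X)+\sum_iE_i+F)$.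
   Formalization: The probabilities $0<p<1$ of probabilistic choice, and the weights $p_i$ of iterated choices, are rational numbers. -}

module Defs where

open import Data.Nat using (ℕ; zero; suc)
open import Data.Rational using (ℚ; 0ℚ; 1ℚ; _<_; _*_; _+_; _-_)
open import Data.Product using (_×_; _,_; proj₁; proj₂)
open import Data.Sum using (_⊎_)
open import Data.List using (List; []; _∷_; map)
open import Relation.Binary.PropositionalEquality using (_≡_)
open import Relation.Nullary using (¬_)
open import Level using (Level) renaming (suc to lsuc; zero to lzero)

-- Variables are de Bruijn indices (ℕ); `rec` binds index 0.
-- Act is an arbitrary set, with a distinguished element τ (given below).

infixl 6 _⊞_

mutual
  data NExpr (Act : Set) : Set where
    nil  : NExpr Act
    var  : ℕ → NExpr Act
    act  : Act → PExpr Act → NExpr Act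
    rec  : NExpr Act → NExpr Act
    _⊞_  : NExpr Act → NExpr Act → NExpr Act

  data PExpr (Act : Set) : Set where
    dirac  : NExpr Act → PExpr Act
    choice : (p : ℚ) → .(0ℚ < p) → .(p < 1ℚ) → PExpr Act → PExpr Act → PExpr Act

module _ {Act : Set} where

  ext : (ℕ → ℕ) → ℕ → ℕ
  ext ρ zero    = zero
  ext ρ (suc n) = suc (ρ n)

  mutual
    renN : (ℕ → ℕ) → NExpr Act → NExpr Act
    renN ρ nil       = nil
    renN ρ (var n)   = var (ρ n)
    renN ρ (act a P) = act a (renP ρ P)
    renN ρ (rec E)   = rec (renN (ext ρ) E)
    renN ρ (E ⊞ F)   = renN ρ E ⊞ renN ρ F

    renP : (ℕ → ℕ) → PExpr Act → PExpr Act
    renP ρ (dirac E)            = dirac (renN ρ E)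
    renP ρ (choice p h₁ h₂ P Q) = choice p h₁ h₂ (renP ρ P) (renP ρ Q)

  exts : (ℕ → NExpr Act) → ℕ → NExpr Act
  exts σ zero    = var zero
  exts σ (suc n) = renN suc (σ n)

  mutual
    subN : (ℕ → NExpr Act) → NExpr Act → NExpr Act
    subN σ nil       = nil
    subN σ (var n)   = σ n
    subN σ (act a P) = act a (subP σ P)
    subN σ (rec E)   = rec (subN (exts σ) E)
    subN σ (E ⊞ F)   = subN σ E ⊞ subN σ F

    subP : (ℕ → NExpr Act) → PExpr Act → PExpr Act
    subP σ (dirac E)            = dirac (subN σ E)
    subP σ (choice p h₁ h₂ P Q) = choice p h₁ h₂ (subP σ P) (subP σ Q)

  single : NExpr Act → ℕ → NExpr Act
  single F zero    = F
  single F (suc n) = var n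

  _[_/0] : NExpr Act → NExpr Act → NExpr Act
  E [ F /0] = subN (single F) E

  -- Iterated probabilistic choice ⨁_i p_i P_i over a nonempty finite list
  -- of (weight, expression) pairs, as right-nested binary choices:
  -- Iter ws Q  means  Q is the iterated choice of ws.
  scale : ℚ → ℚ × PExpr Act → ℚ × PExpr Act
  scale c (w , R) = (c * w , R)

  data Iter : List (ℚ × PExpr Act) → PExpr Act → Set where
    one  : ∀ {P} → Iter ((1ℚ , P) ∷ []) P
    more : ∀ {P Q ws} (p : ℚ) .(h₁ : 0ℚ < p) .(h₂ : p < 1ℚ) → Iter ws Q →
           Iter ((p , P) ∷ map (scale (1ℚ - p)) ws) (choice p h₁ h₂ P Q)

  sum1 : NExpr Act → List (NExpr Act) → NExpr Act
  sum1 E []       = E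
  sum1 E (F ∷ Fs) = E ⊞ sum1 F Fs

VSet : Set₁
VSet = ℕ → Set

｛_｝ : ℕ → VSet
｛ X ｝ = λ y → y ≡ X

_≐_ : VSet → VSet → Set
V ≐ W = ∀ y → (V y → W y) × (W y → V y)

module _ {Act : Set} (τ : Act) where

  -- the relation E ▷ V (least relation; sets taken extensionally)
  mutual
    data _▷_ : NExpr Act → VSet → Set₁ where
      ▷var  : ∀ X → var X ▷ ｛ X ｝
      ▷tau  : ∀ {P V} → P ▷ᴾ V → act τ P ▷ V
      ▷rec  : ∀ {E V} → E ▷ V → ¬ (V ≐ ｛ 0 ｝) → rec E ▷ (λ n → V (suc n))
      ▷sumˡ : ∀ {E F V} → E ▷ V → (E ⊞ F) ▷ V
      ▷sumʳ : ∀ {E F V} → F ▷ V → (E ⊞ F) ▷ V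
      ▷ext  : ∀ {E V W} → E ▷ V → V ≐ W → E ▷ W

    data _▷ᴾ_ : PExpr Act → VSet → Set₁ where
      ▷dirac  : ∀ {E V} → E ▷ V → dirac E ▷ᴾ V
      ▷choice : ∀ {P Q V W p} .{h₁ : 0ℚ < p} .{h₂ : p < 1ℚ} →
                P ▷ᴾ V → Q ▷ᴾ W → choice p h₁ h₂ P Q ▷ᴾ (λ n → V n ⊎ W n)
      ▷extᴾ   : ∀ {P V W} → P ▷ᴾ V → V ≐ W → P ▷ᴾ W

  Guarded : ℕ → NExpr Act → Set₁
  Guarded X E = ¬ (E ▷ ｛ X ｝)

  mutual
    data _≈_ : NExpr Act → NExpr Act → Set₁ where
      reflN  : ∀ {E} → E ≈ E
      symN   : ∀ {E F} → E ≈ F → F ≈ E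
      transN : ∀ {E F G} → E ≈ F → F ≈ G → E ≈ G
      cong-act : ∀ {α P Q} → P ≈ᴾ Q → act α P ≈ act α Q
      cong-rec : ∀ {E F} → E ≈ F → rec E ≈ rec F
      cong-⊞   : ∀ {E E′ F F′} → E ≈ E′ → F ≈ F′ → (E ⊞ F) ≈ (E′ ⊞ F′)
      N1 : ∀ {E F} → (E ⊞ F) ≈ (F ⊞ E)
      N2 : ∀ {E F G} → (E ⊞ (F ⊞ G)) ≈ ((E ⊞ F) ⊞ G)
      N3 : ∀ {E} → (E ⊞ E) ≈ E
      N4 : ∀ {E} → (E ⊞ nil) ≈ E
      T1 : ∀ {α E P p} .{h₁ : 0ℚ < p} .{h₂ : p < 1ℚ} →
           act α (choice p h₁ h₂ (dirac (act τ (dirac E))) P)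
             ≈ act α (choice p h₁ h₂ (dirac E) P)
      -- T2: τ.⨁ p_i (E_i + F) + F = τ.⨁ p_i (E_i + F)
      T2 : ∀ {F Q} (ws : List (ℚ × NExpr Act)) →
           Iter (map (λ w → proj₁ w , dirac (proj₂ w ⊞ F)) ws) Q →
           (act τ Q ⊞ F) ≈ act τ Q
      -- T3: τ.⨁ p_i (E_i + α.P_i) + α.⨁ p_i P_i = τ.⨁ p_i (E_i + α.P_i)
      T3 : ∀ {α Q₁ Q₂} (ts : List (ℚ × NExpr Act × PExpr Act)) →
           Iter (map (λ t → proj₁ t , dirac (proj₁ (proj₂ t) ⊞ act α (proj₂ (proj₂ t)))) ts) Q₁ →
           Iter (map (λ t → proj₁ t , proj₂ (proj₂ t)) ts) Q₂ →
           (act τ Q₁ ⊞ act α Q₂) ≈ act τ Q₁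
      -- T4: α.⨁ p_i (E_i + τ.P_i) + α.⨁ p_i P_i = α.⨁ p_i (E_i + τ.P_i)
      T4 : ∀ {α Q₁ Q₂} (ts : List (ℚ × NExpr Act × PExpr Act)) →
           Iter (map (λ t → proj₁ t , dirac (proj₁ (proj₂ t) ⊞ act τ (proj₂ (proj₂ t)))) ts) Q₁ →
           Iter (map (λ t → proj₁ t , proj₂ (proj₂ t)) ts) Q₂ →
           (act α Q₁ ⊞ act α Q₂) ≈ act α Q₁
      C : ∀ {α P Q p} .{h₁ : 0ℚ < p} .{h₂ : p < 1ℚ} →
          (act α P ⊞ act α Q) ≈ ((act α P ⊞ act α (choice p h₁ h₂ P Q)) ⊞ act α Q)
      R1 : ∀ {E} → rec E ≈ (E [ rec E /0])
      R2 : ∀ {E F} → F ≈ (E [ F /0]) → Guarded 0 E → F ≈ rec E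
      R3 : ∀ {E F P p} .{h₁ : 0ℚ < p} .{h₂ : p < 1ℚ} →
           rec (act τ (choice p h₁ h₂ (dirac (var 0 ⊞ E)) P) ⊞ F)
             ≈ rec ((act τ (choice p h₁ h₂ (dirac (var 0 ⊞ E)) P) ⊞ act τ P) ⊞ F)
      R4 : ∀ {E} → rec (var 0 ⊞ E) ≈ rec E
      R5 : ∀ {E} → rec (act τ (dirac (var 0)) ⊞ E) ≈ rec (act τ (dirac E))
      -- R6: rec X.(τ.⨁ p_i (X + E_i) + F) = rec X.(τ.∂(X) + Σ_i E_i + F)
      R6 : ∀ {F Q} (w : ℚ) (E : NExpr Act) (ws : List (ℚ × NExpr Act)) →
           Iter (map (λ v → proj₁ v , dirac (var 0 ⊞ proj₂ v)) ((w , E) ∷ ws)) Q →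
           rec (act τ Q ⊞ F) ≈ rec ((act τ (dirac (var 0)) ⊞ sum1 E (map proj₂ ws)) ⊞ F)

    data _≈ᴾ_ : PExpr Act → PExpr Act → Set₁ where
      reflP  : ∀ {P} → P ≈ᴾ P
      symP   : ∀ {P Q} → P ≈ᴾ Q → Q ≈ᴾ P
      transP : ∀ {P Q R} → P ≈ᴾ Q → Q ≈ᴾ R → P ≈ᴾ R
      cong-dirac  : ∀ {E F} → E ≈ F → dirac E ≈ᴾ dirac F
      cong-choice : ∀ {P P′ Q Q′ p} .{h₁ : 0ℚ < p} .{h₂ : p < 1ℚ} →
                    P ≈ᴾ P′ → Q ≈ᴾ Q′ → choice p h₁ h₂ P Q ≈ᴾ choice p h₁ h₂ P′ Q′
      P1 : ∀ {P Q p q} .{h₁ : 0ℚ < p} .{h₂ : p < 1ℚ} .{k₁ : 0ℚ < q} .{k₂ : q < 1ℚ} →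
           q ≡ 1ℚ - p → choice p h₁ h₂ P Q ≈ᴾ choice q k₁ k₂ Q P
      -- P2: P ⊕_p (Q ⊕_b R) = (P ⊕_{p'} Q) ⊕_s R
      --     where (with q = b(1-p)) s = p + q and p' = p/(p+q), i.e. p'·s = p
      P2 : ∀ {P Q R p b p′ s}
             .{h₁ : 0ℚ < p} .{h₂ : p < 1ℚ} .{i₁ : 0ℚ < b} .{i₂ : b < 1ℚ}
             .{j₁ : 0ℚ < p′} .{j₂ : p′ < 1ℚ} .{k₁ : 0ℚ < s} .{k₂ : s < 1ℚ} →
           s ≡ p + b * (1ℚ - p) → p′ * s ≡ p →
           choice p h₁ h₂ P (choice b i₁ i₂ Q R) ≈ᴾ choice s k₁ k₂ (choice p′ j₁ j₂ P Q) R
      P3 : ∀ {P p} .{h₁ : 0ℚ < p} .{h₂ : p < 1ℚ} → choice p h₁ h₂ P P ≈ᴾ P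

module Submission where

-- A direct induction on E ▷ {X} fails: below a probabilistic choice the set V in
-- E ▷ V grows (∂(X) ⊕ ∂(Y) ▷ {X, Y}), and then E absorbs no single variable, only the
-- whole choice.  So we prove the stronger invariant (reaches / decompose): if E ▷ V,
-- then E = E + G for a *target* G with variables exactly V, where G is either a
-- variable y or τ.⨁ᵢ pᵢ ∂(yᵢ + Eᵢ), a probabilistic choice over a *variable tree*.
-- The case τ.P wraps every branch of P in a τ-prefix (T1) and collects the
-- branch targets into one variable tree (T3, T4); the case rec X.E first removes the
-- X-branches of the target (R3) and then unfolds the recursion (R1).  For V = {X} the
-- target is X itself or τ.⨁ᵢ pᵢ ∂(Eᵢ + X), which absorbs X by T2.
--
-- The axioms T2 and T3 speak about right-nested iterated choices ⨁ᵢ pᵢ Pᵢ, while the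
-- invariant produces arbitrary choice trees; P1 and P2 (commutativity and
-- reassociation of ⊕) reconcile the two.

open import Defs
open import Data.Nat using (ℕ; zero; suc; pred)
import Data.Nat as ℕ
open import Data.Nat.Properties using (suc-injective; +-comm; +-suc; 0≢1+n; ≤-reflexive)
open import Data.Nat.Induction using (<-wellFounded)
open import Data.Rational using (ℚ; 0ℚ; 1ℚ; ½; _<_; _*_; _+_; _-_; -_; 1/_; positive; _<?_)
open import Data.Rational.Properties
  using ( +-inverseʳ; +-monoˡ-<; +-identityˡ; +-mono-<; positive⁻¹; pos*pos⇒pos; pos⇒nonZero
        ; 1/pos⇒pos; *-inverseˡ; *-assoc; *-identityʳ)
open import Data.Rational.Solver using (module +-*-Solver)
open import Data.Product using (Σ; _×_; _,_; proj₁; proj₂; map₁)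
open import Data.Sum using (_⊎_; inj₁; inj₂; [_,_]; map; map₂; swap; assocʳ; assocˡ)
open import Data.List using (List; []; _∷_)
open import Data.List.Properties using (map-∘)
import Data.List as List
open import Data.Empty using (⊥-elim)
open import Function using (_∘_)
open import Induction.WellFounded using (Acc; acc)
open import Relation.Nullary using (¬_; Dec; yes; no)
open import Relation.Nullary.Decidable using (toWitness; recompute; _⊎-dec_)
open import Level using () renaming (zero to lzero; suc to lsuc)
open import Relation.Binary.Bundles using (Setoid)
import Relation.Binary.Reasoning.Setoid as SetoidReasoning
open import Relation.Binary.PropositionalEquality
  using (_≡_; refl; sym; trans; cong; cong₂; subst; subst₂; module ≡-Reasoning)

open +-*-Solver

In01 : ℚ → Set
In01 p = (0ℚ < p) × (p < 1ℚ)

Prob : Set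
Prob = Σ ℚ In01

0<b-a : ∀ {a b} → a < b → 0ℚ < b - a
0<b-a {a} {b} a<b = subst (_< b - a) (+-inverseʳ a) (+-monoˡ-< (- a) a<b)

0<b-a⇒a<b : ∀ {a b} → 0ℚ < b - a → a < b
0<b-a⇒a<b {a} {b} h =
  subst₂ _<_ (+-identityˡ a) (solve 2 (λ a b → (b :- a) :+ a := b) refl a b) (+-monoˡ-< a h)

0<+ : ∀ {a b} → 0ℚ < a → 0ℚ < b → 0ℚ < a + b
0<+ {a} {b} 0<a 0<b = subst (_< a + b) (+-identityˡ 0ℚ) (+-mono-< 0<a 0<b)

0<* : ∀ {a b} → 0ℚ < a → 0ℚ < b → 0ℚ < a * b
0<* {a} {b} 0<a 0<b = positive⁻¹ (a * b) {{pos*pos⇒pos a {{positive 0<a}} b {{positive 0<b}}}}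

complement : Prob → Prob
complement (p , 0<p , p<1) =
  1ℚ - p , 0<b-a p<1 ,
  0<b-a⇒a<b (subst (0ℚ <_) (solve 1 (λ p → p := con 1ℚ :- (con 1ℚ :- p)) refl p) 0<p)

-- ½ = 1 - ½ definitionally, which makes P ⊕_½ Q = Q ⊕_½ P an instance of P1
half : Prob
half = ½ , toWitness {a? = 0ℚ <? ½} _ , toWitness {a? = ½ <? 1ℚ} _

module _ {a c : ℚ} (0<a : 0ℚ < a) (0<c : 0ℚ < c) where
  private
    0<a+c : 0ℚ < a + c
    0<a+c = 0<+ 0<a 0<c

    inv : ℚ
    inv = (1/ (a + c)) {{pos⇒nonZero (a + c) {{positive 0<a+c}}}}

    0<inv : 0ℚ < inv
    0<inv = positive⁻¹ inv {{1/pos⇒pos (a + c) {{positive 0<a+c}}}}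

    inv-law : inv * (a + c) ≡ 1ℚ
    inv-law = *-inverseˡ (a + c) {{pos⇒nonZero (a + c) {{positive 0<a+c}}}}

  ratio : Prob
  ratio = a * inv , 0<* 0<a 0<inv , 0<b-a⇒a<b (subst (0ℚ <_) c/[a+c] (0<* 0<c 0<inv))
    where
    open ≡-Reasoning
    c/[a+c] : c * inv ≡ 1ℚ - a * inv
    c/[a+c] = begin
      c * inv                 ≡⟨ solve 3 (λ a c i → c :* i := i :* (a :+ c) :- a :* i) refl a c inv ⟩
      inv * (a + c) - a * inv ≡⟨ cong (_- a * inv) inv-law ⟩
      1ℚ - a * inv            ∎

  ratio-law : proj₁ ratio * (a + c) ≡ a
  ratio-law = begin
    a * inv * (a + c)   ≡⟨ *-assoc a inv (a + c) ⟩
    a * (inv * (a + c)) ≡⟨ cong (a *_) inv-law ⟩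
    a * 1ℚ              ≡⟨ *-identityʳ a ⟩
    a                   ∎
    where open ≡-Reasoning

record Reassoc (p b p′ s : Prob) : Set where
  constructor reassoc-by
  field
    outer : proj₁ s ≡ proj₁ p + proj₁ b * (1ℚ - proj₁ p)
    inner : proj₁ p′ * proj₁ s ≡ proj₁ p

-- P2 applies from left to right for all p, b: s = p + b(1-p) and p′ = p/s
toLeft : (p b : Prob) → Σ Prob λ p′ → Σ Prob λ s → Reassoc p b p′ s
toLeft (p , 0<p , p<1) (b , 0<b , b<1) = ratio 0<p 0<c , s , reassoc-by refl (ratio-law 0<p 0<c)
  where
  0<c : 0ℚ < b * (1ℚ - p)
  0<c = 0<* 0<b (0<b-a p<1)
  1-s : (1ℚ - p) * (1ℚ - b) ≡ 1ℚ - (p + b * (1ℚ - p))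
  1-s = solve 2 (λ p b → (con 1ℚ :- p) :* (con 1ℚ :- b) := con 1ℚ :- (p :+ b :* (con 1ℚ :- p))) refl p b
  s : Prob
  s = p + b * (1ℚ - p) , 0<+ 0<p 0<c , 0<b-a⇒a<b (subst (0ℚ <_) 1-s (0<* (0<b-a p<1) (0<b-a b<1)))

-- P2 applies from right to left for all p′, s: p = p′s and b = s(1-p′)/(1-p)
toRight : (p′ s : Prob) → Σ Prob λ p → Σ Prob λ b → Reassoc p b p′ s
toRight (p′ , 0<p′ , p′<1) (s , 0<s , s<1) = p , b , reassoc-by s-law refl
  where
  a : ℚ
  a = s * (1ℚ - p′)
  0<a = 0<* 0<s (0<b-a p′<1)
  0<1-s = 0<b-a s<1
  split-1-p : a + (1ℚ - s) ≡ 1ℚ - p′ * s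
  split-1-p = solve 2 (λ p′ s → s :* (con 1ℚ :- p′) :+ (con 1ℚ :- s) := con 1ℚ :- p′ :* s) refl p′ s
  p : Prob
  p = p′ * s , 0<* 0<p′ 0<s , 0<b-a⇒a<b (subst (0ℚ <_) split-1-p (0<+ 0<a 0<1-s))
  b : Prob
  b = ratio 0<a 0<1-s
  s-law : s ≡ p′ * s + proj₁ b * (1ℚ - p′ * s)
  s-law = begin
    s                                   ≡⟨ solve 2 (λ p′ s → s := p′ :* s :+ s :* (con 1ℚ :- p′)) refl p′ s ⟩
    p′ * s + a                          ≡⟨ cong (p′ * s +_) (sym (ratio-law 0<a 0<1-s)) ⟩
    p′ * s + proj₁ b * (a + (1ℚ - s))   ≡⟨ cong (λ x → p′ * s + proj₁ b * x) split-1-p ⟩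
    p′ * s + proj₁ b * (1ℚ - p′ * s)    ∎
    where open ≡-Reasoning

_∪_ : VSet → VSet → VSet
(V ∪ W) z = V z ⊎ W z

-- the variables free in rec E when V are free in E (de Bruijn: drop 0, shift down)
lower : VSet → VSet
lower V z = V (suc z)

≐-refl : ∀ {V} → V ≐ V
≐-refl z = (λ v → v) , (λ v → v)

≐-sym : ∀ {V W} → V ≐ W → W ≐ V
≐-sym V≐W z = proj₂ (V≐W z) , proj₁ (V≐W z)

≐-trans : ∀ {U V W} → U ≐ V → V ≐ W → U ≐ W
≐-trans U≐V V≐W z = (λ u → proj₁ (V≐W z) (proj₁ (U≐V z) u)) , (λ w → proj₂ (U≐V z) (proj₂ (V≐W z) w))

∪-cong : ∀ {V V′ W W′} → V ≐ V′ → W ≐ W′ → (V ∪ W) ≐ (V′ ∪ W′)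
∪-cong V≐V′ W≐W′ z = map (proj₁ (V≐V′ z)) (proj₁ (W≐W′ z)) , map (proj₂ (V≐V′ z)) (proj₂ (W≐W′ z))

∪-assoc : ∀ {U V W} → ((U ∪ V) ∪ W) ≐ (U ∪ (V ∪ W))
∪-assoc z = assocʳ , assocˡ

∪-comm : ∀ {V W} → (V ∪ W) ≐ (W ∪ V)
∪-comm z = swap , swap

∪-leftComm : ∀ {U V W} → (U ∪ (V ∪ W)) ≐ (V ∪ (U ∪ W))
∪-leftComm z = [ inj₂ ∘ inj₁ , map₂ inj₂ ] , [ inj₂ ∘ inj₁ , map₂ inj₂ ]

lower-cong : ∀ {V W} → V ≐ W → lower V ≐ lower W
lower-cong V≐W z = V≐W (suc z)

lower-｛suc｝ : ∀ {y} → lower ｛ suc y ｝ ≐ ｛ y ｝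
lower-｛suc｝ z = suc-injective , cong suc

lower-drop-0 : ∀ {V} → lower (｛ 0 ｝ ∪ V) ≐ lower V
lower-drop-0 z = [ (λ ()) , (λ v → v) ] , inj₂

private
  variable
    A B : Set

data Tree (A : Set) : Set where
  leaf : A → Tree A
  node : Prob → Tree A → Tree A → Tree A

_>>=_ : Tree A → (A → Tree B) → Tree B
leaf a     >>= h = h a
node r t u >>= h = node r (t >>= h) (u >>= h)

mapTree : (A → B) → Tree A → Tree B
mapTree f t = t >>= (leaf ∘ f)

size : Tree A → ℕ
size (leaf _)     = 1
size (node _ t u) = size t ℕ.+ size u

⋃ : Tree A → (A → VSet) → VSet
⋃ (leaf a)     f = f a
⋃ (node _ t u) f = ⋃ t f ∪ ⋃ u f

⋃-dec : ∀ (f : A → VSet) z → (∀ a → Dec (f a z)) → ∀ t → Dec (⋃ t f z)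
⋃-dec f z f? (leaf a)     = f? a
⋃-dec f z f? (node _ t u) = ⋃-dec f z f? t ⊎-dec ⋃-dec f z f? u

⋃-cong : ∀ {f g : A → VSet} → (∀ a → f a ≐ g a) → ∀ t → ⋃ t f ≐ ⋃ t g
⋃-cong f≐g (leaf a)     = f≐g a
⋃-cong f≐g (node _ t u) = ∪-cong (⋃-cong f≐g t) (⋃-cong f≐g u)

⋃-bind : ∀ (h : A → Tree B) (f : B → VSet) t → ⋃ (t >>= h) f ≐ ⋃ t (λ a → ⋃ (h a) f)
⋃-bind h f (leaf a)     = ≐-refl
⋃-bind h f (node _ t u) = ∪-cong (⋃-bind h f t) (⋃-bind h f u)

-- Right-nested choices a₁ ⊕ (a₂ ⊕ (… ⊕ aₙ)), the shape of ⨁ᵢ pᵢ Pᵢ in the axioms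
data Comb (A : Set) : Set where
  last : A → Comb A
  cons : A → Prob → Comb A → Comb A

-- the comb of t ⊕_r c, computed by reassociating to the right
append : Prob → Comb A → Comb A → Comb A
append r (last a)      c = cons a r c
append r (cons a r′ d) c =
  let (p , b , _) = toRight r′ r in cons a p (append b d c)

flatten : Tree A → Comb A
flatten (leaf a)     = last a
flatten (node r t u) = append r (flatten t) (flatten u)

weights : Comb A → List (ℚ × A)
weights (last a)     = (1ℚ , a) ∷ []
weights (cons a r c) = (proj₁ r , a) ∷ List.map (map₁ ((1ℚ - proj₁ r) *_)) (weights c)

-- Variable trees: a leaf (y , E) stands for the branch ∂(y + E).
VTree : Set → Set
VTree Act = Tree (ℕ × NExpr Act)

vars : ∀ {Act} → VTree Act → VSet
vars Q = ⋃ Q (λ l → ｛ proj₁ l ｝)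

zero-var? : ∀ {Act} (Q : VTree Act) → Dec (vars Q 0)
zero-var? = ⋃-dec _ 0 (λ l → 0 ℕ.≟ proj₁ l)

nonzero-var? : ∀ {Act} (Q : VTree Act) → Σ ℕ (lower (vars Q)) ⊎ (vars Q ≐ ｛ 0 ｝)
nonzero-var? (leaf (zero , E))  = inj₂ ≐-refl
nonzero-var? (leaf (suc y , E)) = inj₁ (y , refl)
nonzero-var? (node r t u) with nonzero-var? t | nonzero-var? u
... | inj₁ (z , z∈t) | _              = inj₁ (z , inj₁ z∈t)
... | inj₂ _         | inj₁ (z , z∈u) = inj₁ (z , inj₂ z∈u)
... | inj₂ t≐0       | inj₂ u≐0       = inj₂ (λ z → [ proj₁ (t≐0 z) , proj₁ (u≐0 z) ] , inj₁ ∘ proj₂ (t≐0 z))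

-- The variable tree obtained by substituting R for 0 in a tree without 0-leaves:
-- leaf variables are lowered by one (see shift-law).
shift : ∀ {Act} → NExpr Act → VTree Act → VTree Act
shift R = mapTree (λ l → pred (proj₁ l) , subN (single R) (proj₂ l))

shift-vars : ∀ {Act} (R : NExpr Act) Q → ¬ vars Q 0 → vars (shift R Q) ≐ lower (vars Q)
shift-vars R (leaf (zero , E))  0∉Q = ⊥-elim (0∉Q refl)
shift-vars R (leaf (suc y , E)) 0∉Q = ≐-sym lower-｛suc｝
shift-vars R (node r t u)       0∉Q =
  ∪-cong (shift-vars R t (0∉Q ∘ inj₁)) (shift-vars R u (0∉Q ∘ inj₂))

data Target (Act : Set) : Set where
  var-target : ℕ → Target Act
  τ-target   : VTree Act → Target Act

varsᵗ : ∀ {Act} → Target Act → VSet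
varsᵗ (var-target y) = ｛ y ｝
varsᵗ (τ-target Q)   = vars Q

module _ {Act : Set} (τ : Act) where

  infix 4 _≋_ _≋ᴾ_ _≽_ _⇄_

  _≋_ : NExpr Act → NExpr Act → Set₁
  _≋_ = _≈_ τ

  _≋ᴾ_ : PExpr Act → PExpr Act → Set₁
  _≋ᴾ_ = _≈ᴾ_ τ

  ≋-setoid : Setoid lzero (lsuc lzero)
  ≋-setoid = record
    { Carrier = NExpr Act ; _≈_ = _≋_
    ; isEquivalence = record { refl = reflN ; sym = symN ; trans = transN } }

  module ≋-Reasoning = SetoidReasoning ≋-setoid

  ch : Prob → PExpr Act → PExpr Act → PExpr Act
  ch (p , 0<p , p<1) P Q = choice p 0<p p<1 P Q

  swap-ch : ∀ r P Q → ch r P Q ≋ᴾ ch (complement r) Q P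
  swap-ch r P Q = P1 refl

  reassoc : ∀ {p b p′ s} → Reassoc p b p′ s → ∀ P Q R → ch p P (ch b Q R) ≋ᴾ ch s (ch p′ P Q) R
  reassoc (reassoc-by outer inner) P Q R = P2 outer inner

  ⨁ : (A → PExpr Act) → Tree A → PExpr Act
  ⨁ g (leaf a)     = g a
  ⨁ g (node r t u) = ch r (⨁ g t) (⨁ g u)

  ⨁-cong : ∀ {g g′ : A → PExpr Act} → (∀ a → g a ≋ᴾ g′ a) → ∀ t → ⨁ g t ≋ᴾ ⨁ g′ t
  ⨁-cong g≋g′ (leaf a)     = g≋g′ a
  ⨁-cong g≋g′ (node r t u) = cong-choice (⨁-cong g≋g′ t) (⨁-cong g≋g′ u)

  ⨁-bind : ∀ (g : B → PExpr Act) (h : A → Tree B) t → ⨁ g (t >>= h) ≡ ⨁ (⨁ g ∘ h) t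
  ⨁-bind g h (leaf a)     = refl
  ⨁-bind g h (node r t u) = cong₂ (ch r) (⨁-bind g h t) (⨁-bind g h u)

  ⨁ᶜ : (A → PExpr Act) → Comb A → PExpr Act
  ⨁ᶜ g (last a)     = g a
  ⨁ᶜ g (cons a r c) = ch r (g a) (⨁ᶜ g c)

  append-≋ : ∀ (g : A → PExpr Act) r c d → ch r (⨁ᶜ g c) (⨁ᶜ g d) ≋ᴾ ⨁ᶜ g (append r c d)
  append-≋ g r (last a)       d = reflP
  append-≋ g r (cons a r′ c) d =
    let (p , b , law) = toRight r′ r in
    transP (symP (reassoc law (g a) (⨁ᶜ g c) (⨁ᶜ g d))) (cong-choice reflP (append-≋ g b c d))

  flatten-≋ : ∀ (g : A → PExpr Act) t → ⨁ g t ≋ᴾ ⨁ᶜ g (flatten t)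
  flatten-≋ g (leaf a)     = reflP
  flatten-≋ g (node r t u) =
    transP (cong-choice (flatten-≋ g t) (flatten-≋ g u)) (append-≋ g r (flatten t) (flatten u))

  comb-Iter : ∀ (g : A → PExpr Act) c →
    Iter (List.map (λ w → proj₁ w , g (proj₂ w)) (weights c)) (⨁ᶜ g c)
  comb-Iter g (last a)     = one
  comb-Iter g (cons a r c) =
    subst (λ ws → Iter ((proj₁ r , g a) ∷ ws) (⨁ᶜ g (cons a r c)))
          (trans (sym (map-∘ (weights c))) (map-∘ (weights c)))
          (more (proj₁ r) (proj₁ (proj₂ r)) (proj₂ (proj₂ r)) (comb-Iter g c))

  T2-tree : ∀ F (t : Tree (NExpr Act)) →
    act τ (⨁ (λ E → dirac (E ⊞ F)) t) ⊞ F ≋ act τ (⨁ (λ E → dirac (E ⊞ F)) t)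
  T2-tree F t =
    transN (cong-⊞ (cong-act flat) reflN)
      (transN (T2 (weights (flatten t)) (comb-Iter g (flatten t))) (cong-act (symP flat)))
    where
    g = λ E → dirac (E ⊞ F)
    flat = flatten-≋ g t

  T3-tree : ∀ α (t : Tree (NExpr Act × PExpr Act)) →
    act τ (⨁ (λ x → dirac (proj₁ x ⊞ act α (proj₂ x))) t) ⊞ act α (⨁ proj₂ t)
      ≋ act τ (⨁ (λ x → dirac (proj₁ x ⊞ act α (proj₂ x))) t)
  T3-tree α t =
    transN (cong-⊞ (cong-act flat) (cong-act (flatten-≋ proj₂ t)))
      (transN (T3 (weights (flatten t)) (comb-Iter g (flatten t)) (comb-Iter proj₂ (flatten t)))
              (cong-act (symP flat)))
    where
    g = λ x → dirac (proj₁ x ⊞ act α (proj₂ x))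
    flat = flatten-≋ g t

  _⇄_ : PExpr Act → PExpr Act → Set₁
  P ⇄ P′ = ∀ α X r → act α (ch r X P) ≋ act α (ch r X P′)

  ⇄-trans : ∀ {P P′ P″} → P ⇄ P′ → P′ ⇄ P″ → P ⇄ P″
  ⇄-trans P⇄P′ P′⇄P″ α X r = transN (P⇄P′ α X r) (P′⇄P″ α X r)

  τ-branch : ∀ E → dirac E ⇄ dirac (act τ (dirac E))
  τ-branch E α X r =
    transN (cong-act (swap-ch r X (dirac E)))
      (transN (symN T1) (cong-act (symP (swap-ch r X (dirac (act τ (dirac E)))))))

  -- ⇄ passes into the right branch of a choice by reassociation (P2) ...
  ⇄-right : ∀ r P {Q Q′} → Q ⇄ Q′ → ch r P Q ⇄ ch r P Q′
  ⇄-right r P {Q} {Q′} Q⇄Q′ α X r₀ =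
    let (p′ , s , law) = toLeft r₀ r in
    transN (cong-act (reassoc law X P Q))
      (transN (Q⇄Q′ α (ch p′ X P) s) (cong-act (symP (reassoc law X P Q′))))

  -- ... and into the left branch by commutativity (P1)
  ⇄-left : ∀ r {P P′} Q → P ⇄ P′ → ch r P Q ⇄ ch r P′ Q
  ⇄-left r {P} {P′} Q P⇄P′ α X r₀ =
    transN (cong-act (cong-choice reflP (swap-ch r P Q)))
      (transN (⇄-right (complement r) Q P⇄P′ α X r₀)
              (cong-act (cong-choice reflP (symP (swap-ch r P′ Q)))))

  ⇄-tree : ∀ {g g′ : A → PExpr Act} → (∀ a → g a ⇄ g′ a) → ∀ t → ⨁ g t ⇄ ⨁ g′ t
  ⇄-tree g⇄g′ (leaf a)     = g⇄g′ a
  ⇄-tree {g = g} {g′} g⇄g′ (node r t u) =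
    ⇄-trans (⇄-left r (⨁ g u) (⇄-tree g⇄g′ t)) (⇄-right r (⨁ g′ t) (⇄-tree g⇄g′ u))

  -- interchangeable branches give equal prefixed expressions, by
  -- α.P = α.(P ⊕½ P) = α.(P ⊕½ P′) = α.(P′ ⊕½ P) = α.(P′ ⊕½ P′) = α.P′  (P3, P1)
  ⇄-act : ∀ α {P P′} → P ⇄ P′ → act α P ≋ act α P′
  ⇄-act α {P} {P′} P⇄P′ =
    transN (cong-act (symP P3))
      (transN (P⇄P′ α P half)
        (transN (cong-act (swap-ch half P P′))
          (transN (P⇄P′ α P′ half) (cong-act P3))))

  τ-prefix-branches : ∀ α (h : A → NExpr Act) t →
    act α (⨁ (dirac ∘ h) t) ≋ act α (⨁ (λ a → dirac (act τ (dirac (h a)))) t)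
  τ-prefix-branches α h t = ⇄-act α (⇄-tree (τ-branch ∘ h) t)

  _≽_ : NExpr Act → NExpr Act → Set₁
  E ≽ G = E ≋ E ⊞ G

  ≽-respˡ : ∀ {E E′ G} → E ≋ E′ → E′ ≽ G → E ≽ G
  ≽-respˡ E≋E′ E′≽G = transN E≋E′ (transN E′≽G (cong-⊞ (symN E≋E′) reflN))

  ≽-trans : ∀ {E F G} → E ≽ F → F ≽ G → E ≽ G
  ≽-trans {E} {F} {G} E≽F F≽G = begin
    E             ≈⟨ E≽F ⟩
    E ⊞ F         ≈⟨ cong-⊞ reflN F≽G ⟩
    E ⊞ (F ⊞ G)   ≈⟨ N2 ⟩
    (E ⊞ F) ⊞ G   ≈⟨ cong-⊞ (symN E≽F) reflN ⟩
    E ⊞ G         ∎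
    where open ≋-Reasoning

  ⊞-≽ˡ : ∀ {E F G} → E ≽ G → E ⊞ F ≽ G
  ⊞-≽ˡ E≽G = transN (cong-⊞ E≽G reflN) (transN (symN N2) (transN (cong-⊞ reflN N1) N2))

  ⊞-≽ʳ : ∀ {E F G} → F ≽ G → E ⊞ F ≽ G
  ⊞-≽ʳ F≽G = transN (cong-⊞ reflN F≽G) N2

  record Split (t : Tree A) (a : A) : Set₁ where
    field
      weight  : Prob
      rest    : Tree A
      law     : ∀ g → ⨁ g t ≋ᴾ ch weight (g a) (⨁ g rest)
      smaller : size t ≡ suc (size rest)
      leaves  : ∀ f → ⋃ t f ≐ (f a ∪ ⋃ rest f)

  extract : ∀ (f : A → VSet) z r t u → ⋃ (node r t u) f z → Σ A λ a → f a z × Split (node r t u) a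
  extract f z r (leaf a) u (inj₁ fa) =
    a , fa , record { weight = r ; rest = u ; law = λ g → reflP ; smaller = refl ; leaves = λ f → ≐-refl }
  extract f z r (node q t₁ t₂) u (inj₁ m) with extract f z q t₁ t₂ m
  ... | a , fa , S =
    let open Split S
        (p , b , r-law) = toRight weight r
    in a , fa , record
      { weight  = p
      ; rest    = node b rest u
      ; law     = λ g → transP (cong-choice (law g) reflP) (symP (reassoc r-law (g a) (⨁ g rest) (⨁ g u)))
      ; smaller = cong (ℕ._+ size u) smaller
      ; leaves  = λ f → ≐-trans (∪-cong (leaves f) ≐-refl) ∪-assoc
      }
  extract f z r t (leaf a) (inj₂ fa) =
    a , fa , record { weight = complement r ; rest = t ; law = λ g → swap-ch r (⨁ g t) (g a)
                    ; smaller = +-comm (size t) 1 ; leaves = λ f → ∪-comm }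
  extract f z r t (node q u₁ u₂) (inj₂ m) with extract f z q u₁ u₂ m
  ... | a , fa , S =
    let open Split S
        (p′ , s , l-law) = toLeft r weight
        (p , b , r-law)  = toRight (complement p′) s
    in a , fa , record
      { weight  = p
      ; rest    = node b t rest
      ; law     = λ g → transP (cong-choice reflP (law g))
                    (transP (reassoc l-law (⨁ g t) (g a) (⨁ g rest))
                    (transP (cong-choice (swap-ch p′ (⨁ g t) (g a)) reflP)
                            (symP (reassoc r-law (g a) (⨁ g t) (⨁ g rest)))))
      ; smaller = trans (cong (size t ℕ.+_) smaller) (+-suc (size t) (size rest))
      ; leaves  = λ f → ≐-trans (∪-cong ≐-refl (leaves f)) ∪-leftComm
      }

  branch : ℕ × NExpr Act → PExpr Act
  branch (y , E) = dirac (var y ⊞ E)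

  ⟦_⟧ᵛ : VTree Act → PExpr Act
  ⟦_⟧ᵛ = ⨁ branch

  ⟦_⟧ᵗ : Target Act → NExpr Act
  ⟦ var-target y ⟧ᵗ = var y
  ⟦ τ-target Q ⟧ᵗ   = act τ ⟦ Q ⟧ᵛ

  shift-law : ∀ R Q → ¬ vars Q 0 → subP (single R) ⟦ Q ⟧ᵛ ≡ ⟦ shift R Q ⟧ᵛ
  shift-law R (leaf (zero , E))  0∉Q = ⊥-elim (0∉Q refl)
  shift-law R (leaf (suc y , E)) 0∉Q = refl
  shift-law R (node r t u)       0∉Q = cong₂ (ch r) (shift-law R t (0∉Q ∘ inj₁)) (shift-law R u (0∉Q ∘ inj₂))

  unfold-summand : ∀ B G → rec (B ⊞ G) ≽ G [ rec (B ⊞ G) /0]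
  unfold-summand B G = symN (begin
    R ⊞ G [ R /0]                          ≈⟨ cong-⊞ R1 reflN ⟩
    (B [ R /0] ⊞ G [ R /0]) ⊞ G [ R /0]    ≈⟨ symN N2 ⟩
    B [ R /0] ⊞ (G [ R /0] ⊞ G [ R /0])    ≈⟨ cong-⊞ reflN N3 ⟩
    B [ R /0] ⊞ G [ R /0]                  ≈⟨ symN R1 ⟩
    R                                      ∎)
    where
    open ≋-Reasoning
    R = rec (B ⊞ G)

  R3-step : ∀ {B P P₁ E₀ r} → P ≋ᴾ ch r (dirac (var 0 ⊞ E₀)) P₁ →
    rec (B ⊞ act τ P) ≋ rec ((B ⊞ act τ P) ⊞ act τ P₁)
  R3-step {B} {P} {P₁} {E₀} {r} P≋ = begin
    rec (B ⊞ act τ P)                  ≈⟨ cong-rec (transN (cong-⊞ reflN (cong-act P≋)) N1) ⟩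
    rec (act τ P′ ⊞ B)                 ≈⟨ R3 ⟩
    rec ((act τ P′ ⊞ act τ P₁) ⊞ B)    ≈⟨ cong-rec (transN N1 N2) ⟩
    rec ((B ⊞ act τ P′) ⊞ act τ P₁)    ≈⟨ cong-rec (cong-⊞ (cong-⊞ reflN (cong-act (symP P≋))) reflN) ⟩
    rec ((B ⊞ act τ P) ⊞ act τ P₁)     ∎
    where
    open ≋-Reasoning
    P′ = ch r (dirac (var 0 ⊞ E₀)) P₁

  record Pruned (B : NExpr Act) (Q : VTree Act) : Set₁ where
    field
      body      : NExpr Act
      tree      : VTree Act
      0∉tree    : ¬ vars tree 0
      same-vars : lower (vars Q) ≐ lower (vars tree)
      rec-eq    : rec (B ⊞ act τ ⟦ Q ⟧ᵛ) ≋ rec (body ⊞ act τ ⟦ tree ⟧ᵛ)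

  -- R3 removes one 0-leaf at a time; Q must have a nonzero variable, so it never
  -- shrinks to a single 0-leaf.  Recursion is on the number of leaves.
  prune : ∀ B Q → Acc ℕ._<_ (size Q) → Σ ℕ (lower (vars Q)) → Pruned B Q
  prune B Q _ _ with zero-var? Q
  ... | no 0∉Q = record { body = B ; tree = Q ; 0∉tree = 0∉Q ; same-vars = ≐-refl ; rec-eq = reflN }
  prune B (leaf (y , E)) _ (z , suc-z≡y) | yes 0≡y = ⊥-elim (0≢1+n (trans 0≡y (sym suc-z≡y)))
  prune B Q@(node r t u) (acc smaller-acc) (z , z∈Q) | yes 0∈Q
    with extract (λ l → ｛ proj₁ l ｝) 0 r t u 0∈Q
  ... | (.0 , E₀) , refl , S = record
    { body      = body
    ; tree      = tree
    ; 0∉tree    = 0∉tree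
    ; same-vars = ≐-trans vars-rest same-vars
    ; rec-eq    = transN (R3-step {r = weight} (law branch)) rec-eq
    }
    where
    open Split S
    vars-rest : lower (vars Q) ≐ lower (vars rest)
    vars-rest = ≐-trans (lower-cong (leaves (λ l → ｛ proj₁ l ｝))) (lower-drop-0 {vars rest})
    open Pruned (prune (B ⊞ act τ ⟦ Q ⟧ᵛ) rest (smaller-acc (≤-reflexive (sym smaller)))
                       (z , proj₁ (vars-rest z) z∈Q))

  record Reaches (E : NExpr Act) (V : VSet) : Set₁ where
    constructor reaching
    field
      target  : Target Act
      vars≐   : V ≐ varsᵗ target
      absorbs : E ≽ ⟦ target ⟧ᵗ

  Part : Set
  Part = NExpr Act × Target Act

  partExpr : Part → NExpr Act
  partExpr (E , T) = E ⊞ ⟦ T ⟧ᵗ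

  record Decomposition (P : PExpr Act) (V : VSet) : Set₁ where
    constructor decomposed
    field
      tree  : Tree Part
      shape : P ≋ᴾ ⨁ (dirac ∘ partExpr) tree
      vars≐ : V ≐ ⋃ tree (varsᵗ ∘ proj₂)

  contribution : Part → VTree Act
  contribution (E , var-target y) = leaf (y , E)
  contribution (E , τ-target Q)   = Q

  contribution-vars : ∀ l → vars (contribution l) ≐ varsᵗ (proj₂ l)
  contribution-vars (E , var-target y) = ≐-refl
  contribution-vars (E , τ-target Q)   = ≐-refl

  part-absorbs : ∀ l → act τ (dirac (partExpr l)) ≽ act τ ⟦ contribution l ⟧ᵛ
  part-absorbs (E , var-target y) = transN (symN N3) (cong-⊞ reflN (cong-act (cong-dirac N1)))
  part-absorbs (E , τ-target Q)   = symN (T4 ((1ℚ , E , ⟦ Q ⟧ᵛ) ∷ []) one one)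

  -- τ-prefixing: by T1 every branch gets a τ-prefix, and T3 collects the contributions
  τ-reaches : ∀ {P V} → Decomposition P V → Reaches (act τ P) V
  τ-reaches {P} {V} (decomposed t P≋t V≐t) = reaching (τ-target (t >>= contribution)) vars≐ absorbs
    where
    pair : Part → NExpr Act × PExpr Act
    pair l = act τ (dirac (partExpr l)) , ⟦ contribution l ⟧ᵛ

    g : NExpr Act × PExpr Act → PExpr Act
    g x = dirac (proj₁ x ⊞ act τ (proj₂ x))

    S : Tree (NExpr Act × PExpr Act)
    S = mapTree pair t

    τP≋τS : act τ P ≋ act τ (⨁ g S)
    τP≋τS = begin
      act τ P                                                 ≈⟨ cong-act P≋t ⟩
      act τ (⨁ (dirac ∘ partExpr) t)                          ≈⟨ τ-prefix-branches τ partExpr t ⟩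
      act τ (⨁ (λ l → dirac (act τ (dirac (partExpr l)))) t) ≈⟨ cong-act (⨁-cong (cong-dirac ∘ part-absorbs) t) ⟩
      act τ (⨁ (g ∘ pair) t)                                  ≡⟨ cong (act τ) (sym (⨁-bind g (leaf ∘ pair) t)) ⟩
      act τ (⨁ g S)                                           ∎
      where open ≋-Reasoning

    contributions : ⨁ proj₂ S ≡ ⟦ t >>= contribution ⟧ᵛ
    contributions = trans (⨁-bind proj₂ (leaf ∘ pair) t) (sym (⨁-bind branch contribution t))

    absorbs : act τ P ≽ act τ ⟦ t >>= contribution ⟧ᵛ
    absorbs = ≽-respˡ τP≋τS (subst (λ G → act τ (⨁ g S) ≽ act τ G) contributions (symN (T3-tree τ S)))

    vars≐ : V ≐ vars (t >>= contribution)
    vars≐ = ≐-trans V≐t (≐-sym (≐-trans (⋃-bind contribution _ t) (⋃-cong contribution-vars t)))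

  -- rec X.E: the target is lowered past the binder; 0-leaves are pruned first (R3)
  rec-reaches : ∀ {E V} → Reaches E V → ¬ (V ≐ ｛ 0 ｝) → Reaches (rec E) (lower V)
  rec-reaches (reaching (var-target zero) V≐0 _) V≉0 = ⊥-elim (V≉0 V≐0)
  rec-reaches {E} (reaching (var-target (suc y)) V≐y E≽y) _ =
    reaching (var-target y) (≐-trans (lower-cong V≐y) lower-｛suc｝)
             (≽-respˡ (cong-rec E≽y) (unfold-summand E (var (suc y))))
  rec-reaches {E} {V} (reaching (τ-target Q) V≐Q E≽τQ) V≉0 with nonzero-var? Q
  ... | inj₂ Q≐0 = ⊥-elim (V≉0 (≐-trans V≐Q Q≐0))
  ... | inj₁ w   = reaching (τ-target (shift R tree)) vars≐ absorbs
    where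
    open Pruned (prune E Q (<-wellFounded (size Q)) w)
    R = rec (body ⊞ act τ ⟦ tree ⟧ᵛ)

    absorbs : rec E ≽ act τ ⟦ shift R tree ⟧ᵛ
    absorbs = ≽-respˡ (transN (cong-rec E≽τQ) rec-eq)
                (subst (λ G → R ≽ act τ G) (shift-law R tree 0∉tree) (unfold-summand body (act τ ⟦ tree ⟧ᵛ)))

    vars≐ : lower V ≐ vars (shift R tree)
    vars≐ = ≐-trans (lower-cong V≐Q) (≐-trans same-vars (≐-sym (shift-vars R tree 0∉tree)))

  mutual
    reaches : ∀ {E V} → _▷_ τ E V → Reaches E V
    reaches (▷var X)       = reaching (var-target X) ≐-refl (symN N3)
    reaches (▷tau d)       = τ-reaches (decompose d)
    reaches (▷rec d V≉0)   = rec-reaches (reaches d) V≉0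
    reaches (▷sumˡ d)      = let reaching T V≐T E≽T = reaches d in reaching T V≐T (⊞-≽ˡ E≽T)
    reaches (▷sumʳ d)      = let reaching T V≐T E≽T = reaches d in reaching T V≐T (⊞-≽ʳ E≽T)
    reaches (▷ext d V≐W)   = let reaching T V≐T E≽T = reaches d in reaching T (≐-trans (≐-sym V≐W) V≐T) E≽T

    decompose : ∀ {P V} → _▷ᴾ_ τ P V → Decomposition P V
    decompose (▷dirac {E} d) =
      let reaching T V≐T E≽T = reaches d in decomposed (leaf (E , T)) (cong-dirac E≽T) V≐T
    -- the bounds on p are irrelevant in ▷choice and are recomputed by deciding <
    decompose (▷choice {p = p} {h₁ = 0<p} {h₂ = p<1} d₁ d₂) =
      let decomposed t₁ P≋t₁ V≐t₁ = decompose d₁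
          decomposed t₂ P≋t₂ V≐t₂ = decompose d₂
      in decomposed (node (p , recompute (0ℚ <? p) 0<p , recompute (p <? 1ℚ) p<1) t₁ t₂)
                    (cong-choice P≋t₁ P≋t₂) (∪-cong V≐t₁ V≐t₂)
    decompose (▷extᴾ d V≐W) =
      let decomposed t P≋t V≐t = decompose d in decomposed t P≋t (≐-trans (≐-sym V≐W) V≐t)

  single-var-tree : ∀ X Q → (∀ z → vars Q z → z ≡ X) →
    ⟦ Q ⟧ᵛ ≋ᴾ ⨁ (λ E → dirac (E ⊞ var X)) (mapTree proj₂ Q)
  single-var-tree X (leaf (y , E)) only-X with only-X y refl
  ... | refl = cong-dirac N1
  single-var-tree X (node r t u) only-X =
    cong-choice (single-var-tree X t (λ z → only-X z ∘ inj₁)) (single-var-tree X u (λ z → only-X z ∘ inj₂))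

  absorbs-unguarded : ∀ {E X} → _▷_ τ E ｛ X ｝ → E ≽ var X
  absorbs-unguarded {E} {X} d with reaches d
  ... | reaching (var-target y) X≐y E≽y = subst (λ y → E ≽ var y) (sym (proj₁ (X≐y X) refl)) E≽y
  ... | reaching (τ-target Q) X≐Q E≽τQ =
    ≽-trans E≽τQ (≽-respˡ (cong-act (single-var-tree X Q (λ z → proj₂ (X≐Q z))))
                          (symN (T2-tree (var X) (mapTree proj₂ Q))))

lemma5p2 : {Act : Set} (τ : Act) (E : NExpr Act) (X : ℕ) →
    _▷_ τ E ｛ X ｝ → _≈_ τ E (E ⊞ var X)
lemma5p2 τ E X d = absorbs-unguarded τ d
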